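{- Let $f$ be an ordered binary decision diagram over variables $x_0,x_1,\dots$ with the identity variable order, and let $B \subseteq \mathbb{B}$. Then $C^{B}_{2:f} \le \tfrac{1}{2}\cdot C^{\emptyset}_{1:f} + C^{B}_{1:f}$.
   Context: $\mathbb{B} = \{\bot,\top\}$. An OBDD is a finite DAG with a single source $r$ (the root), whose sinks are among the terminals $\bot,\top$, and in which every non-terminal node $v$ has a label $\mathrm{label}(v)\in\mathbb{N}$ and exactly two outgoing arcs (low and high; arcs form a multiset), with $\mathrm{label}(v_1) < \mathrm{label}(v_2)$ for every arc $v_1 \to v_2$ between non-terminal nodes. Convention: the DAG is augmented by an extra vertex $\rho$ and an arc $\rho \to r$, with levelisation $\mathcal{L}(\rho)=0$, $\mathcal{L}(v) = \mathrm{label}(v)+1$ for non-terminal $v$, $\mathcal{L}(\bot)=\mathcal{L}(\top)=\infty$. For $B \subseteq \mathbb{B}$ let $w_B$ assign weight $1$ to an arc whose target is a non-terminal node or a terminal in $B$, and weight $0$ otherwise. A cut is a partition $(S,T)$ of the vertex set, with weight the sum of $w_B$ over arcs from $S$ to $T$. For $i\ge 1$, an $i$-level cut is a cut $(S,T)$ such that for some $j\in\mathbb{N}$, $\mathcal{L}(s) < j+i$ for all $s \in S$ and $\mathcal{L}(t) > j$ for all $t \in T$. $C^B_{i:f}$ is the maximum weight (w.r.t. $w_B$) of an $i$-level cut of the augmented DAG of $f$. -}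

module Defs where

open import Data.Nat using (ℕ; zero; suc; _+_; _*_; _<_; _≤_)
open import Data.Bool using (Bool; true; false; _∧_; not; if_then_else_)
open import Data.Fin using (Fin)
open import Data.List using (List; []; _∷_; map; concatMap; allFin)
open import Data.Nat.ListAction using (sum)
open import Data.Product using (Σ; _×_; _,_)
open import Data.Sum using (_⊎_; inj₁; inj₂)
open import Data.Empty using (⊥)
open import Data.Unit using (⊤)
open import Relation.Binary.PropositionalEquality using (_≡_)

-- A child of a node: a non-terminal node (Fin n) or a terminal (false = ⊥, true = ⊤).
Child : ℕ → Set
Child n = Fin n ⊎ Bool

-- An OBDD with n non-terminal nodes (variables x₀, x₁, … in identity order).
record OBDD : Set where
  field
    n     : ℕ
    label : Fin n → ℕ
    low   : Fin n → Child n
    high  : Fin n → Child n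
    root  : Child n

open OBDD public

-- Vertices of the augmented DAG: ρ, non-terminal nodes, terminals.
data Vtx (n : ℕ) : Set where
  ρ  : Vtx n
  nd : Fin n → Vtx n
  tm : Bool → Vtx n

embed : ∀ {n} → Child n → Vtx n
embed (inj₁ i) = nd i
embed (inj₂ b) = tm b

data Reach (f : OBDD) : Vtx (n f) → Set where
  reach-root : Reach f (embed (root f))
  reach-low  : ∀ {i} → Reach f (nd i) → Reach f (embed (low f i))
  reach-high : ∀ {i} → Reach f (nd i) → Reach f (embed (high f i))

LabelOrdered : OBDD → Set
LabelOrdered f = ∀ i j → (embed (low f i) ≡ nd j ⊎ embed (high f i) ≡ nd j)
                   → label f i < label f j

IsOBDD : OBDD → Set
IsOBDD f = LabelOrdered f × (∀ i → Reach f (nd i))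

data Level : Set where
  fin : ℕ → Level
  ∞   : Level

𝓛 : (f : OBDD) → Vtx (n f) → Level
𝓛 f ρ      = fin 0
𝓛 f (nd i) = fin (suc (label f i))
𝓛 f (tm b) = ∞

_<ᴸ_ : Level → ℕ → Set
fin a <ᴸ k = a < k
∞     <ᴸ k = ⊥

_<ᴿ_ : ℕ → Level → Set
k <ᴿ fin a = k < a
k <ᴿ ∞     = ⊤

-- Arcs of the augmented DAG (a multiset, as a list of (source, target)).
arcs : (f : OBDD) → List (Vtx (n f) × Vtx (n f))
arcs f = (ρ , embed (root f))
       ∷ concatMap (λ i → (nd i , embed (low f i)) ∷ (nd i , embed (high f i)) ∷ []) (allFin (n f))

Subset𝔹 : Set
Subset𝔹 = Bool → Bool

∅𝔹 : Subset𝔹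
∅𝔹 _ = false

-- Arc weight w_B, determined by the arc's target.
w : ∀ {n} → Subset𝔹 → Vtx n → ℕ
w B ρ      = 1   -- never occurs as a target
w B (nd i) = 1
w B (tm b) = if B b then 1 else 0

-- A cut (S,T) is given by S : Vtx → Bool (true = in S, false = in T).
Cut : OBDD → Set
Cut f = Vtx (n f) → Bool

cutWeight : (f : OBDD) → Subset𝔹 → Cut f → ℕ
cutWeight f B S = sum (map arcW (arcs f))
  where
    arcW : Vtx (n f) × Vtx (n f) → ℕ
    arcW (s , t) = if S s ∧ not (S t) then w B t else 0

IsLevelCut : (f : OBDD) → ℕ → Cut f → Set
IsLevelCut f i S = Σ ℕ λ j →
    (∀ v → S v ≡ true  → 𝓛 f v <ᴸ (j + i))
  × (∀ v → S v ≡ false → j <ᴿ 𝓛 f v)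

IsMaxCut : (f : OBDD) → Subset𝔹 → ℕ → ℕ → Set
IsMaxCut f B i m =
    (Σ (Cut f) λ S → IsLevelCut f i S × cutWeight f B S ≡ m)
  × (∀ S → IsLevelCut f i S → cutWeight f B S ≤ m)

-- Take a maximum 2-level cut S between levels j and j+2: vertices of level ≤ j lie in S, those
-- of level ≥ j+2 do not, and the middle layer M is the set of level-(j+1) nodes in S. Arc by arc,
-- twice the weight of S, plus a charge of 2 on each arc entering M, is at most the weight of the
-- 1-level cut just above level j (under ∅ and under B), plus that of the 1-level cut just above
-- level j+1, plus the weight of the arcs leaving M. Each node of M has two outgoing arcs and, being reachable, at least one
-- incoming arc, so the charges pay for the arcs leaving M.
module Submission where

open import Defs
open import Data.Nat using (ℕ; suc; _+_; _*_; _≤_; _<_; z≤n; s≤s)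
open import Data.Nat.Properties
open import Algebra.Properties.CommutativeSemigroup +-commutativeSemigroup using (interchange)
open import Data.Nat.ListAction using (sum)
open import Data.Nat.ListAction.Properties using (sum-↭)
open import Data.Bool using (Bool; true; false; _∧_; not; if_then_else_)
open import Data.Bool.Properties using (∧-zeroʳ)
open import Data.Empty using (⊥; ⊥-elim)
open import Data.Unit using (⊤; tt)
open import Data.Fin using (Fin)
open import Data.List using (List; []; _∷_; _++_; [_]; map; concatMap; allFin)
open import Data.List.Properties using (map-∘)
open import Data.List.Membership.Propositional using (_∈_)
open import Data.List.Membership.Propositional.Properties using (∈-map⁺; ∈-map⁻; ∈-concatMap⁺; ∈-∃++)
open import Data.List.Relation.Binary.Subset.Propositional using (_⊆_)
open import Data.List.Relation.Binary.Permutation.Propositional.Properties using (shift; ∈-resp-↭)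
  renaming (map⁺ to ↭-map⁺)
open import Data.List.Relation.Unary.All as All using (All; []; _∷_)
open import Data.List.Relation.Unary.All.Properties as All using ()
open import Data.List.Relation.Unary.Any using (here; there)
open import Data.List.Relation.Unary.Any.Properties as Any using ()
open import Data.List.Relation.Unary.AllPairs using (_∷_)
open import Data.List.Relation.Unary.Unique.Propositional using (Unique)
open import Data.List.Relation.Unary.Unique.Propositional.Properties as Unique using (allFin⁺)
open import Data.Product using (_×_; _,_; proj₁; proj₂)
open import Data.Sum using (inj₁; inj₂)
open import Function using (_∘_)
open import Relation.Binary using (tri<; tri≈; tri>)
open import Relation.Binary.PropositionalEquality
  using (_≡_; _≢_; refl; sym; trans; cong; subst; module ≡-Reasoning)
open import Relation.Nullary using (contradiction)

module _ {a} {A : Set a} where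

  sum-map-+ : (g h : A → ℕ) (xs : List A) →
              sum (map (λ x → g x + h x) xs) ≡ sum (map g xs) + sum (map h xs)
  sum-map-+ g h []       = refl
  sum-map-+ g h (x ∷ xs) = trans (cong (g x + h x +_) (sum-map-+ g h xs))
                              (interchange (g x) (h x) (sum (map g xs)) (sum (map h xs)))

  sum-map-mono : {g h : A → ℕ} {xs : List A} →
                 All (λ x → g x ≤ h x) xs → sum (map g xs) ≤ sum (map h xs)
  sum-map-mono []           = z≤n
  sum-map-mono (gx≤hx ∷ le) = +-mono-≤ gx≤hx (sum-map-mono le)

  ⊆-delete : ∀ {y : A} {ys : List A} (us vs : List A) → All (y ≢_) ys → ys ⊆ us ++ [ y ] ++ vs → ys ⊆ us ++ vs
  ⊆-delete {y} us vs y∉ys ys⊆ x∈ys with ∈-resp-↭ (shift y us vs) (ys⊆ x∈ys)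
  ... | here x≡y       = contradiction (sym x≡y) (All.lookup y∉ys x∈ys)
  ... | there x∈us++vs = x∈us++vs

  sum-map-mono-⊆ : (h : A → ℕ) {xs ys : List A} →
                   Unique ys → ys ⊆ xs → sum (map h ys) ≤ sum (map h xs)
  sum-map-mono-⊆ h {ys = []}     _               _     = z≤n
  sum-map-mono-⊆ h {ys = y ∷ ys} (y∉ys ∷ unique) ys⊆xs
    with us , vs , refl ← ∈-∃++ (ys⊆xs (here refl)) = begin
      h y + sum (map h ys)              ≤⟨ +-monoʳ-≤ (h y) (sum-map-mono-⊆ h unique
                                             (⊆-delete us vs y∉ys (ys⊆xs ∘ there))) ⟩
      h y + sum (map h (us ++ vs))      ≡⟨ sum-↭ (↭-map⁺ h (shift y us vs)) ⟨
      sum (map h (us ++ [ y ] ++ vs))   ∎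
    where open ≤-Reasoning

sum-map-concatMap-pair : ∀ {a b} {A : Set a} {B : Set b} (g : B → ℕ) (l r : A → B) (xs : List A) →
  sum (map g (concatMap (λ x → l x ∷ r x ∷ []) xs)) ≡ sum (map (λ x → g (l x) + g (r x)) xs)
sum-map-concatMap-pair g l r []       = refl
sum-map-concatMap-pair g l r (x ∷ xs) =
  trans (sym (+-assoc (g (l x)) (g (r x)) _)) (cong (g (l x) + g (r x) +_) (sum-map-concatMap-pair g l r xs))

data Zone : Set where
  below middle above : Zone

zone : ℕ → Level → Zone
zone j (fin a) with <-cmp a (suc j)
... | tri< _ _ _ = below
... | tri≈ _ _ _ = middle
... | tri> _ _ _ = above
zone j ∞ = above

isBelow isMiddle isAbove : Zone → Bool
isBelow below = true
isBelow _     = false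
isMiddle middle = true
isMiddle _      = false
isAbove above = true
isAbove _     = false

below⇒<ᴸ : ∀ j ℓ → isBelow (zone j ℓ) ≡ true → ℓ <ᴸ (j + 1)
below⇒<ᴸ j (fin a) eq with <-cmp a (suc j)
below⇒<ᴸ j (fin a) eq | tri< a<1+j _ _ = subst (a <_) (+-comm 1 j) a<1+j
below⇒<ᴸ j (fin a) () | tri≈ _ _ _
below⇒<ᴸ j (fin a) () | tri> _ _ _
below⇒<ᴸ j ∞       ()

¬below⇒<ᴿ : ∀ j ℓ → isBelow (zone j ℓ) ≡ false → j <ᴿ ℓ
¬below⇒<ᴿ j (fin a) eq with <-cmp a (suc j)
¬below⇒<ᴿ j (fin a) () | tri< _ _ _
¬below⇒<ᴿ j (fin a) eq | tri≈ _ a≡1+j _ = ≤-reflexive (sym a≡1+j)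
¬below⇒<ᴿ j (fin a) eq | tri> _ _ 1+j<a = <⇒≤ 1+j<a
¬below⇒<ᴿ j ∞       eq = tt

¬above⇒<ᴸ : ∀ j ℓ → not (isAbove (zone j ℓ)) ≡ true → ℓ <ᴸ (suc j + 1)
¬above⇒<ᴸ j (fin a) eq with <-cmp a (suc j)
¬above⇒<ᴸ j (fin a) eq | tri< a<1+j _ _ = m<n⇒m<1+n (subst (a <_) (+-comm 1 j) a<1+j)
¬above⇒<ᴸ j (fin a) eq | tri≈ _ a≡1+j _ = s≤s (≤-reflexive (trans a≡1+j (+-comm 1 j)))
¬above⇒<ᴸ j (fin a) () | tri> _ _ _
¬above⇒<ᴸ j ∞       ()

above⇒<ᴿ : ∀ j ℓ → not (isAbove (zone j ℓ)) ≡ false → suc j <ᴿ ℓ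
above⇒<ᴿ j (fin a) eq with <-cmp a (suc j)
above⇒<ᴿ j (fin a) () | tri< _ _ _
above⇒<ᴿ j (fin a) () | tri≈ _ _ _
above⇒<ᴿ j (fin a) eq | tri> _ _ 1+j<a = 1+j<a
above⇒<ᴿ j ∞       eq = tt

Consistent : Zone → Bool → Set
Consistent below  x = x ≡ true
Consistent middle x = ⊤
Consistent above  x = x ≡ false

twoLevel-consistent : ∀ j ℓ x → (x ≡ true → ℓ <ᴸ (j + 2)) → (x ≡ false → j <ᴿ ℓ) →
                      Consistent (zone j ℓ) x
twoLevel-consistent j (fin a) true  <j+2 _ with <-cmp a (suc j)
... | tri< _ _ _     = refl
... | tri≈ _ _ _     = tt
... | tri> _ _ 1+j<a = contradiction (m<1+n⇒m≤n (subst (a <_) (+-comm j 2) (<j+2 refl))) (<⇒≱ 1+j<a)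
twoLevel-consistent j (fin a) false _ j< with <-cmp a (suc j)
... | tri< a<1+j _ _ = contradiction (m<1+n⇒m≤n a<1+j) (<⇒≱ (j< refl))
... | tri≈ _ _ _     = tt
... | tri> _ _ _     = refl
twoLevel-consistent j ∞ true  <j+2 _ = ⊥-elim (<j+2 refl)
twoLevel-consistent j ∞ false _    _ = refl

_<ℓ_ : Level → Level → Set
fin a <ℓ ℓ = a <ᴿ ℓ
∞     <ℓ ℓ = ⊥

data _↝_ : Zone → Zone → Set where
  below↝below  : below  ↝ below
  below↝middle : below  ↝ middle
  below↝above  : below  ↝ above
  middle↝above : middle ↝ above
  above↝above  : above  ↝ above

zone-mono : ∀ j {ℓ ℓ′} → ℓ <ℓ ℓ′ → zone j ℓ ↝ zone j ℓ′
zone-mono j {fin a} {fin b} a<b with <-cmp a (suc j) | <-cmp b (suc j)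
... | tri< _ _ _     | tri< _ _ _    = below↝below
... | tri< _ _ _     | tri≈ _ _ _    = below↝middle
... | tri< _ _ _     | tri> _ _ _    = below↝above
... | tri≈ _ a≡1+j _ | tri< _ _ b≯  = contradiction (subst (_< b) a≡1+j a<b) b≯
... | tri≈ _ a≡1+j _ | tri≈ _ _ b≯  = contradiction (subst (_< b) a≡1+j a<b) b≯
... | tri≈ _ _ _     | tri> _ _ _    = middle↝above
... | tri> _ _ 1+j<a | tri< _ _ b≯  = contradiction (<-trans 1+j<a a<b) b≯
... | tri> _ _ 1+j<a | tri≈ _ _ b≯  = contradiction (<-trans 1+j<a a<b) b≯
... | tri> _ _ _     | tri> _ _ _    = above↝above
zone-mono j {fin a} {∞} _ with <-cmp a (suc j)
... | tri< _ _ _ = below↝above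
... | tri≈ _ _ _ = middle↝above
... | tri> _ _ _ = above↝above

-- x and y are the memberships of the arc's source and target in the 2-level cut,
-- ω∅ and ωB the weights of its target under ∅ and under B.
crossing-bound : ∀ {zs zt} → zs ↝ zt → ∀ {x y} → Consistent zs x → Consistent zt y →
  ∀ {ω∅ ωB} → (zt ≡ middle → ω∅ ≡ 1 × ωB ≡ 1) →
    (if x ∧ not y then ωB else 0) + (if x ∧ not y then ωB else 0)
      + (if y ∧ isMiddle zt then 2 else 0)
  ≤ (if isBelow zs ∧ not (isBelow zt) then ω∅ else 0)
      + (if isBelow zs ∧ not (isBelow zt) then ωB else 0)
      + (if not (isAbove zs) ∧ not (not (isAbove zt)) then ωB else 0)
      + (if x ∧ isMiddle zs then ωB else 0)
crossing-bound below↝below  refl refl _ = z≤n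
crossing-bound below↝middle {y = true}  refl _ unitWeights with unitWeights refl
... | refl , refl = ≤-refl
crossing-bound below↝middle {y = false} refl _ unitWeights with unitWeights refl
... | refl , refl = ≤-refl
crossing-bound below↝above  refl refl {ω∅} {ωB} _ =
  +-monoˡ-≤ 0 (≤-trans (m≤n+m (ωB + ωB) ω∅) (≤-reflexive (sym (+-assoc ω∅ ωB ωB))))
crossing-bound middle↝above {x = true}  _ refl _ = ≤-reflexive (+-identityʳ _)
crossing-bound middle↝above {x = false} _ refl _ = z≤n
crossing-bound above↝above  refl refl _ = z≤n

module _ (f : OBDD) where

  Arc : Set
  Arc = Vtx (n f) × Vtx (n f)

  lowArc highArc : Fin (n f) → Arc
  lowArc  i = nd i , embed (low f i)
  highArc i = nd i , embed (high f i)

  arcSum : (Arc → ℕ) → ℕ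
  arcSum g = sum (map g (arcs f))

  outArcs : Fin (n f) → List Arc
  outArcs i = lowArc i ∷ highArc i ∷ []

  arcs-All : {P : Arc → Set} → P (ρ , embed (root f)) → (∀ i → P (lowArc i)) → (∀ i → P (highArc i)) →
             All P (arcs f)
  arcs-All pr pl ph = pr ∷ All.concat⁺ (All.map⁺ (All.tabulate⁺ (λ i → pl i ∷ ph i ∷ [])))

  sum-arcs : (g : Arc → ℕ) →
    arcSum g ≡ g (ρ , embed (root f)) + sum (map (λ i → g (lowArc i) + g (highArc i)) (allFin (n f)))
  sum-arcs g = cong (g (ρ , embed (root f)) +_) (sum-map-concatMap-pair g lowArc highArc (allFin (n f)))

  arcs-rise : LabelOrdered f → All (λ e → 𝓛 f (proj₁ e) <ℓ 𝓛 f (proj₂ e)) (arcs f)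
  arcs-rise ordered = arcs-All (root-rises (root f))
    (λ i → child-rises i (low f i) (λ k eq → ordered i k (inj₁ eq)))
    (λ i → child-rises i (high f i) (λ k eq → ordered i k (inj₂ eq)))
    where
    root-rises : ∀ c → 0 <ᴿ 𝓛 f (embed c)
    root-rises (inj₁ _) = s≤s z≤n
    root-rises (inj₂ _) = tt
    child-rises : ∀ i c → (∀ k → embed c ≡ nd k → label f i < label f k) → suc (label f i) <ᴿ 𝓛 f (embed c)
    child-rises i (inj₁ k) label< = s≤s (label< k refl)
    child-rises i (inj₂ _) _      = tt

  lowArc∈arcs : ∀ i → lowArc i ∈ arcs f
  lowArc∈arcs i = there (∈-concatMap⁺ outArcs {xs = allFin (n f)} (Any.tabulate⁺ i (here refl)))

  highArc∈arcs : ∀ i → highArc i ∈ arcs f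
  highArc∈arcs i = there (∈-concatMap⁺ outArcs {xs = allFin (n f)} (Any.tabulate⁺ i (there (here refl))))

  reachable⇒target : ∀ {v} → Reach f v → v ∈ map proj₂ (arcs f)
  reachable⇒target reach-root           = here refl
  reachable⇒target (reach-low  {i} _) = ∈-map⁺ proj₂ (lowArc∈arcs i)
  reachable⇒target (reach-high {i} _) = ∈-map⁺ proj₂ (highArc∈arcs i)

  -- Every node is reachable, hence the target of at least one arc.
  sum-nodes≤sum-targets : (∀ i → Reach f (nd i)) → (h : Vtx (n f) → ℕ) →
    sum (map (h ∘ nd) (allFin (n f))) ≤ arcSum (h ∘ proj₂)
  sum-nodes≤sum-targets reachable h = begin
    sum (map (h ∘ nd) (allFin (n f)))     ≡⟨ cong sum (map-∘ (allFin (n f))) ⟩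
    sum (map h (map nd (allFin (n f))))   ≤⟨ sum-map-mono-⊆ h (Unique.map⁺ nd-injective (allFin⁺ (n f)))
                                               nodes⊆targets ⟩
    sum (map h (map proj₂ (arcs f)))      ≡⟨ cong sum (map-∘ (arcs f)) ⟨
    arcSum (h ∘ proj₂)                    ∎
    where
    open ≤-Reasoning
    nodes⊆targets : map nd (allFin (n f)) ⊆ map proj₂ (arcs f)
    nodes⊆targets v∈nodes with _ , _ , refl ← ∈-map⁻ nd v∈nodes = reachable⇒target (reachable _)
    nd-injective : ∀ {i k} → nd {n f} i ≡ nd k → i ≡ k
    nd-injective refl = refl

  lowerCut upperCut : ℕ → Cut f
  lowerCut j v = isBelow (zone j (𝓛 f v))
  upperCut j v = not (isAbove (zone j (𝓛 f v)))

  lowerCut-isLevelCut : ∀ j → IsLevelCut f 1 (lowerCut j)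
  lowerCut-isLevelCut j = j , (λ v → below⇒<ᴸ j (𝓛 f v)) , (λ v → ¬below⇒<ᴿ j (𝓛 f v))

  upperCut-isLevelCut : ∀ j → IsLevelCut f 1 (upperCut j)
  upperCut-isLevelCut j = suc j , (λ v → ¬above⇒<ᴸ j (𝓛 f v)) , (λ v → above⇒<ᴿ j (𝓛 f v))

  crossing : Subset𝔹 → Cut f → Arc → ℕ
  crossing B S (s , t) = if S s ∧ not (S t) then w B t else 0

w≤1 : ∀ {m} B (t : Vtx m) → w B t ≤ 1
w≤1 B ρ      = ≤-refl
w≤1 B (nd _) = ≤-refl
w≤1 B (tm b) with B b
... | true  = ≤-refl
... | false = z≤n

module MiddleLayer (f : OBDD) (B : Subset𝔹) {j : ℕ} {S : Cut f}
  (S-below : ∀ v → S v ≡ true → 𝓛 f v <ᴸ (j + 2)) (T-above : ∀ v → S v ≡ false → j <ᴿ 𝓛 f v) where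

  inMiddle : Vtx (n f) → Bool
  inMiddle v = S v ∧ isMiddle (zone j (𝓛 f v))

  charge : Vtx (n f) → ℕ
  charge v = if inMiddle v then 2 else 0

  leavingMiddle : Arc f → ℕ
  leavingMiddle (s , t) = if inMiddle s then w B t else 0

  arc-bound : ∀ {e} → 𝓛 f (proj₁ e) <ℓ 𝓛 f (proj₂ e) →
    crossing f B S e + crossing f B S e + charge (proj₂ e)
    ≤ crossing f ∅𝔹 (lowerCut f j) e + crossing f B (lowerCut f j) e + crossing f B (upperCut f j) e
      + leavingMiddle e
  arc-bound {s , t} rises =
    crossing-bound (zone-mono j {𝓛 f s} {𝓛 f t} rises) (consistent s) (consistent t)
                   {w ∅𝔹 t} {w B t} (middle-weights t)
    where
    consistent : ∀ v → Consistent (zone j (𝓛 f v)) (S v)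
    consistent v = twoLevel-consistent j (𝓛 f v) (S v) (S-below v) (T-above v)
    middle-weights : ∀ v → zone j (𝓛 f v) ≡ middle → w ∅𝔹 v ≡ 1 × w B v ≡ 1
    middle-weights ρ      _  = refl , refl
    middle-weights (nd _) _  = refl , refl
    middle-weights (tm _) ()

  cut-bound : LabelOrdered f →
    cutWeight f B S + cutWeight f B S + arcSum f (charge ∘ proj₂)
    ≤ cutWeight f ∅𝔹 (lowerCut f j) + cutWeight f B (lowerCut f j) + cutWeight f B (upperCut f j)
      + arcSum f leavingMiddle
  cut-bound ordered = begin
    arcSum f W + arcSum f W + arcSum f (charge ∘ proj₂)
      ≡⟨ trans (sum-map-+ (λ e → W e + W e) (charge ∘ proj₂) (arcs f))
               (cong (_+ arcSum f (charge ∘ proj₂)) (sum-map-+ W W (arcs f))) ⟨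
    arcSum f (λ e → W e + W e + charge (proj₂ e))
      ≤⟨ sum-map-mono (All.map arc-bound (arcs-rise f ordered)) ⟩
    arcSum f (λ e → L∅ e + L e + U e + leavingMiddle e)
      ≡⟨ trans (sum-map-+ (λ e → L∅ e + L e + U e) leavingMiddle (arcs f))
               (cong (_+ arcSum f leavingMiddle) (trans (sum-map-+ (λ e → L∅ e + L e) U (arcs f))
                                                        (cong (_+ arcSum f U) (sum-map-+ L∅ L (arcs f))))) ⟩
    arcSum f L∅ + arcSum f L + arcSum f U + arcSum f leavingMiddle
      ∎
    where
    open ≤-Reasoning
    W L∅ L U : Arc f → ℕ
    W  = crossing f B S
    L∅ = crossing f ∅𝔹 (lowerCut f j)
    L  = crossing f B (lowerCut f j)
    U  = crossing f B (upperCut f j)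

  leaving≤entering : (∀ i → Reach f (nd i)) → arcSum f leavingMiddle ≤ arcSum f (charge ∘ proj₂)
  leaving≤entering reachable = begin
    arcSum f leavingMiddle
      ≡⟨ sum-arcs f leavingMiddle ⟩
    leavingMiddle (ρ , embed (root f)) + sum (map leavingNode (allFin (n f)))
      -- ρ has level 0, so it is never in the middle layer
      ≡⟨ cong (λ b → (if b then w B (embed (root f)) else 0) + sum (map leavingNode (allFin (n f))))
              (∧-zeroʳ (S ρ)) ⟩
    sum (map leavingNode (allFin (n f)))
      ≤⟨ sum-map-mono (All.universal leavingNode≤charge (allFin (n f))) ⟩
    sum (map (charge ∘ nd) (allFin (n f)))
      ≤⟨ sum-nodes≤sum-targets f reachable charge ⟩
    arcSum f (charge ∘ proj₂)
      ∎
    where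
    open ≤-Reasoning
    leavingNode : Fin (n f) → ℕ
    leavingNode i = leavingMiddle (lowArc f i) + leavingMiddle (highArc f i)
    leavingNode≤charge : ∀ i → leavingNode i ≤ charge (nd i)
    leavingNode≤charge i with inMiddle (nd i)
    ... | true  = +-mono-≤ (w≤1 B (embed (low f i))) (w≤1 B (embed (high f i)))
    ... | false = z≤n

lemma3 : (f : OBDD) → IsOBDD f → (B : Subset𝔹) → (c2 c0 c1 : ℕ)
    → IsMaxCut f B 2 c2 → IsMaxCut f ∅𝔹 1 c0 → IsMaxCut f B 1 c1
    → 2 * c2 ≤ c0 + 2 * c1
lemma3 f (ordered , reachable) B c2 c0 c1 ((S , (j , S-below , T-above) , weight≡c2) , _) (_ , max∅) (_ , maxB) =
  subst (λ c → 2 * c ≤ c0 + 2 * c1) weight≡c2 (+-cancelʳ-≤ entering _ _ (begin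
    2 * weight + entering
      ≡⟨ cong (λ x → weight + x + entering) (+-identityʳ weight) ⟩
    weight + weight + entering
      ≤⟨ cut-bound ordered ⟩
    cutWeight f ∅𝔹 (lowerCut f j) + cutWeight f B (lowerCut f j) + cutWeight f B (upperCut f j) + leaving
      ≤⟨ +-mono-≤ (+-mono-≤ (+-mono-≤ (max∅ _ (lowerCut-isLevelCut f j)) (maxB _ (lowerCut-isLevelCut f j)))
                            (maxB _ (upperCut-isLevelCut f j)))
                  (leaving≤entering reachable) ⟩
    c0 + c1 + c1 + entering
      ≡⟨ cong (_+ entering) (trans (+-assoc c0 c1 c1) (cong (λ x → c0 + (c1 + x)) (sym (+-identityʳ c1)))) ⟩
    c0 + 2 * c1 + entering
      ∎))
  where
  open MiddleLayer f B S-below T-above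
  open ≤-Reasoning
  weight entering leaving : ℕ
  weight   = cutWeight f B S
  entering = arcSum f (charge ∘ proj₂)
  leaving  = arcSum f leavingMiddle
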